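{- For every AB configuration $(A,B)$, $P(A,B)$ is again an AB configuration. Moreover, for every labelled box configuration $\pi$ and every AB configuration $(A,B)$ on $\pi$, $P(A,B)=AB_{\mathrm{base}}(\pi)$.
   Context: Fix partitions $\mu_1,\mu_2,\mu_3$; for a partition $\lambda$ put $\lambda_t=0$ for $t>\ell(\lambda)$ and identify $\lambda$ with $\{(u,v)\in\mathbb{Z}^2:v\ge0,\ 0\le u<\lambda_{v+1}\}$. Cells are elements of $\mathbb{Z}^3$; $BN(w)=\{w-e_1,w-e_2,w-e_3\}$. Define $\mathrm{Cyl}_1=\{(x,u,v):(u,v)\in\mu_1\}$, $\mathrm{Cyl}_2=\{(v,y,u):(u,v)\in\mu_2\}$, $\mathrm{Cyl}_3=\{(u,v,z):(u,v)\in\mu_3\}$, $\mathrm{Cyl}_i^-=\mathrm{Cyl}_i\setminus\mathbb{Z}^3_{\ge0}$, $\mathrm{I}^-=\bigcup_i\mathrm{Cyl}_i^-$, $\mathrm{II}_{\bar1}=\mathrm{Cyl}_2\cap\mathrm{Cyl}_3\setminus\mathrm{Cyl}_1$, $\mathrm{II}_{\bar2}=\mathrm{Cyl}_3\cap\mathrm{Cyl}_1\setminus\mathrm{Cyl}_2$, $\mathrm{II}_{\bar3}=\mathrm{Cyl}_1\cap\mathrm{Cyl}_2\setminus\mathrm{Cyl}_3$, $\mathrm{II}=\bigcup_i\mathrm{II}_{\bar i}$, $\mathrm{III}=\mathrm{Cyl}_1\cap\mathrm{Cyl}_2\cap\mathrm{Cyl}_3$. Labelled box configuration: with $V=\mathbb{C}^3/\mathbb{C}(1,1,1)$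 and $\langle\mathbf i\rangle$ the line spanned by the image of the $i$-th basis vector, it is a finite set $B\subseteq\mathrm{I}^-\cup\mathrm{II}\cup\mathrm{III}$ (boxes), a subset $U\subseteq B\cap\mathrm{III}$ (unlabelled boxes), and a line of $V$ (label) for each $w\in(B\cap\mathrm{III})\setminus U$, such that (1) $w\in\mathrm{I}^-$ with a box in $BN(w)$ is a box; (2) $w\in\mathrm{II}_{\bar i}$ such that some box $n\in BN(w)$ is not a type III box labelled $\langle\mathbf i\rangle$ is a box; (3) for $w\in\mathrm{III}$, with $S$ the span of the subspaces induced by boxes in $BN(w)$ (box in $\mathrm{Cyl}_j^-$: $\langle\mathbf j\rangle$; labelled type III box: its label; unlabelled type III box: $V$), $S\ne0$ forces $w$ to be a box, $\dim S=1$ forces $w$ labelled $S$ or unlabelled, $\dim S=2$ forces $w$ unlabelled. An AB configuration is a pair of finite sets $A\subseteq\mathrm{I}^-\cup\mathrm{III}$, $B\subseteq\mathrm{II}\cup\mathrm{III}$ with: $w\in\mathrm{I}^-\cup\mathrm{III}$ and $BN(w)\cap A\ne\emptyset$ imply $w\in A$; $w\in\mathrm{II}\cup\mathrm{III}$ and $BN(w)\cap B\ne\emptyset$ imply $w\in B$. It is on $\pi$ if $A\cup B$ is the set of boxes of $\pi$ and $A\cap B$ is the set of unlabelled type III boxes of $\pi$. $AB_{\mathrm{base}}(\pi)=(A,B)$ with $A$ the boxes of $\pi$ in $\mathrm{I}^-\cup\mathrm{III}$ and $B$ the type II boxes plus the unlabelled type III boxes of $\pi$. $P(A,B)=(A\cup(\mathrm{III}\cap(B\setminus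 A)),\ B\setminus(\mathrm{III}\cap(B\setminus A)))$. -}

module Defs where

open import Data.Bool using (Bool; true; false; _∧_; _∨_; not; T)
open import Data.Nat using (ℕ; zero; suc; _<ᵇ_; _≥_; _<_)
open import Data.Integer using (ℤ; +_; -[1+_]; _-_; 1ℤ)
open import Data.List using (List; []; _∷_)
open import Data.List.Relation.Unary.All using (All)
open import Data.List.Relation.Unary.Linked using (Linked)
open import Data.List.Membership.Propositional using (_∈_)
open import Data.Fin using (Fin; zero; suc)
open import Data.Product using (Σ; ∃; _×_; _,_)
open import Data.Sum using (_⊎_)
open import Relation.Binary.PropositionalEquality using (_≡_; _≢_)
open import Relation.Nullary using (¬_)

record Partition : Set where
  field
    parts         : List ℕ
    nonincreasing : Linked _≥_ parts
    positive      : All (λ p → 0 < p) parts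

-- part μ t = μ_{t+1}, with μ_{t+1} = 0 for t+1 > ℓ(μ)
part : Partition → ℕ → ℕ
part μ = go (Partition.parts μ)
  where
  go : List ℕ → ℕ → ℕ
  go []       _       = 0
  go (p ∷ ps) zero    = p
  go (p ∷ ps) (suc t) = go ps t

inPart : Partition → ℤ → ℤ → Bool
inPart μ (+ u) (+ v) = u <ᵇ part μ v
inPart μ (+ u) -[1+ v ] = false
inPart μ -[1+ u ] v = false

Cell : Set
Cell = ℤ × ℤ × ℤ

Subset : Set
Subset = Cell → Bool

Finite : Subset → Set
Finite X = Σ (List Cell) λ l → ∀ w → T (X w) → w ∈ l

isNonneg : ℤ → Bool
isNonneg (+ _) = true
isNonneg -[1+ _ ] = false

nonneg : Cell → Bool
nonneg (x , y , z) = isNonneg x ∧ isNonneg y ∧ isNonneg z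

-- w - e_i  (i = 0,1,2 stands for e_1,e_2,e_3)
shift : Fin 3 → Cell → Cell
shift zero             (x , y , z) = (x - 1ℤ , y , z)
shift (suc zero)       (x , y , z) = (x , y - 1ℤ , z)
shift (suc (suc zero)) (x , y , z) = (x , y , z - 1ℤ)

BN : Cell → Cell → Set
BN w n = Σ (Fin 3) λ i → n ≡ shift i w

module Regions (μ₁ μ₂ μ₃ : Partition) where

  -- Cyl i  stands for Cyl_{i+1}
  Cyl : Fin 3 → Subset
  Cyl zero             (x , y , z) = inPart μ₁ y z
  Cyl (suc zero)       (x , y , z) = inPart μ₂ z x
  Cyl (suc (suc zero)) (x , y , z) = inPart μ₃ x y

  Cyl⁻ : Fin 3 → Subset
  Cyl⁻ i w = Cyl i w ∧ not (nonneg w)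

  I⁻ : Subset
  I⁻ w = Cyl⁻ zero w ∨ Cyl⁻ (suc zero) w ∨ Cyl⁻ (suc (suc zero)) w

  -- IIbar i  stands for II_{\overline{i+1}}
  IIbar : Fin 3 → Subset
  IIbar zero             w = Cyl (suc zero) w ∧ Cyl (suc (suc zero)) w ∧ not (Cyl zero w)
  IIbar (suc zero)       w = Cyl (suc (suc zero)) w ∧ Cyl zero w ∧ not (Cyl (suc zero) w)
  IIbar (suc (suc zero)) w = Cyl zero w ∧ Cyl (suc zero) w ∧ not (Cyl (suc (suc zero)) w)

  II : Subset
  II w = IIbar zero w ∨ IIbar (suc zero) w ∨ IIbar (suc (suc zero)) w

  III : Subset
  III w = Cyl zero w ∧ Cyl (suc zero) w ∧ Cyl (suc (suc zero)) w

  record IsAB (A B : Subset) : Set where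
    field
      finiteA : Finite A
      finiteB : Finite B
      A⊆      : ∀ w → T (A w) → T (I⁻ w ∨ III w)
      B⊆      : ∀ w → T (B w) → T (II w ∨ III w)
      closedA : ∀ w n → T (I⁻ w ∨ III w) → BN w n → T (A n) → T (A w)
      closedB : ∀ w n → T (II w ∨ III w) → BN w n → T (B n) → T (B w)

  moved : Subset → Subset → Subset
  moved A B w = III w ∧ B w ∧ not (A w)

  P₁ : Subset → Subset → Subset
  P₁ A B w = A w ∨ moved A B w

  P₂ : Subset → Subset → Subset
  P₂ A B w = B w ∧ not (moved A B w)

  -- L : the set of lines of V = ℂ³/ℂ(1,1,1);  e i = ⟨ i+1 ⟩
  module Labels (L : Set) (e : Fin 3 → L) where

    labelled : (box unl : Subset) → Subset
    labelled box unl w = box w ∧ III w ∧ not (unl w)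

    InducesLine : (box unl : Subset) (lab : Cell → L) → Cell → L → Set
    InducesLine box unl lab n ℓ =
      (Σ (Fin 3) λ j → T (box n ∧ Cyl⁻ j n) × ℓ ≡ e j)
      ⊎ (T (labelled box unl n) × lab n ≡ ℓ)

    InducesV : (box unl : Subset) → Cell → Set
    InducesV box unl n = T (box n ∧ III n ∧ unl n)

    SpanNonzero : (box unl : Subset) (lab : Cell → L) → Cell → Set
    SpanNonzero box unl lab w =
      Σ Cell λ n → BN w n × (InducesV box unl n ⊎ Σ L (InducesLine box unl lab n))

    -- S is the line ℓ (dim S = 1): since V is 2-dimensional, the span of a
    -- family of lines and copies of V is the line ℓ iff the family is nonempty
    -- and consists only of the line ℓ.
    SpanIsLine : (box unl : Subset) (lab : Cell → L) → Cell → L → Set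
    SpanIsLine box unl lab w ℓ =
      (Σ Cell λ n → BN w n × InducesLine box unl lab n ℓ)
      × (∀ n → BN w n → ¬ InducesV box unl n)
      × (∀ n m → BN w n → InducesLine box unl lab n m → m ≡ ℓ)

    -- S = V (dim S = 2): some V, or two distinct lines
    SpanIsV : (box unl : Subset) (lab : Cell → L) → Cell → Set
    SpanIsV box unl lab w =
      (Σ Cell λ n → BN w n × InducesV box unl n)
      ⊎ (Σ Cell λ n → Σ Cell λ n' → Σ L λ ℓ → Σ L λ ℓ' →
           BN w n × BN w n' × InducesLine box unl lab n ℓ
           × InducesLine box unl lab n' ℓ' × ℓ ≢ ℓ')

    -- labelled box configurations; lab w is the label of w, only meaningful
    -- when w is a labelled type III box
    record LBC : Set where
      field
        box    : Subset
        unl    : Subset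
        lab    : Cell → L
        finite : Finite box
        box⊆   : ∀ w → T (box w) → T (I⁻ w ∨ II w ∨ III w)
        unl⊆   : ∀ w → T (unl w) → T (box w ∧ III w)
        cond1  : ∀ w n → T (I⁻ w) → BN w n → T (box n) → T (box w)
        cond2  : ∀ i w n → T (IIbar i w) → BN w n → T (box n)
                   → ¬ (T (labelled box unl n) × lab n ≡ e i) → T (box w)
        cond3a : ∀ w → T (III w) → SpanNonzero box unl lab w → T (box w)
        cond3b : ∀ w ℓ → T (III w) → SpanIsLine box unl lab w ℓ
                   → T (unl w) ⊎ (T (labelled box unl w) × lab w ≡ ℓ)
        cond3c : ∀ w → T (III w) → SpanIsV box unl lab w → T (unl w)

    On : LBC → Subset → Subset → Set
    On π A B = ∀ w → (A w ∨ B w ≡ LBC.box π w) × (A w ∧ B w ≡ LBC.unl π w)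

    ABbase₁ : LBC → Subset
    ABbase₁ π w = LBC.box π w ∧ (I⁻ w ∨ III w)

    ABbase₂ : LBC → Subset
    ABbase₂ π w = (LBC.box π w ∧ II w) ∨ LBC.unl π w

module Submission where

-- I⁻ lies outside the nonnegative octant while II and III lie inside it, and a cell of
-- II lies in exactly two cylinders, so I⁻, II, III are pairwise disjoint. Given that,
-- P(A,B) = AB_base(π) is a pointwise Boolean identity. III is downward closed inside the
-- octant because partitions are nonincreasing; this makes moving III ∩ (B \ A) from B to A
-- respect both closure conditions: a moved box below w ∈ I⁻ ∪ III forces w ∈ III ∩ B, and a
-- box of B \ A below a moved box lies in the octant, hence in III, and so is moved itself.

open import Defs
open import Data.Bool using (Bool; true; false; _∧_; _∨_; not; T; T?)
open import Data.Bool.Properties using (T-∧; T-∨)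
open import Data.Nat using (ℕ; zero; suc; _≤_; z≤n)
open import Data.Nat.Properties using (<ᵇ⇒<; <⇒<ᵇ; <⇒≤; <-≤-trans)
open import Data.Integer using (ℤ; +_; -[1+_]; 1ℤ; _-_)
open import Data.List using ([]; _∷_; _++_)
open import Data.List.Relation.Unary.All using (_∷_)
open import Data.List.Relation.Unary.Linked using (_∷_)
open import Data.List.Membership.Propositional.Properties using (∈-++⁺ˡ; ∈-++⁺ʳ)
open import Data.Fin using (Fin; zero; suc)
open import Data.Product using (_×_; _,_; proj₁; proj₂)
open import Data.Sum using (_⊎_; inj₁; inj₂; [_,_])
open import Data.Empty using (⊥-elim)
open import Function using (_∘_)
open import Function.Bundles using (Equivalence)
open import Relation.Nullary using (¬_; yes; no)
open import Relation.Binary.PropositionalEquality using (_≡_; refl; trans; cong; cong₂)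

T-∧⁻ : ∀ {a b} → T (a ∧ b) → T a × T b
T-∧⁻ = Equivalence.to T-∧

T-∧⁺ : ∀ {a b} → T a × T b → T (a ∧ b)
T-∧⁺ = Equivalence.from T-∧

T-∧³⁻ : ∀ {a b c} → T (a ∧ b ∧ c) → T a × T b × T c
T-∧³⁻ h = let (p , q) = T-∧⁻ h in p , T-∧⁻ q

T-∧³⁺ : ∀ {a b c} → T a × T b × T c → T (a ∧ b ∧ c)
T-∧³⁺ (p , q) = T-∧⁺ (p , T-∧⁺ q)

T-∨⁺ˡ : ∀ {a b} → T a → T (a ∨ b)
T-∨⁺ˡ = Equivalence.from T-∨ ∘ inj₁

T-∨⁺ʳ : ∀ {a b} → T b → T (a ∨ b)
T-∨⁺ʳ = Equivalence.from T-∨ ∘ inj₂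

T-∨⁻ : ∀ {a b} → T (a ∨ b) → T a ⊎ T b
T-∨⁻ = Equivalence.to T-∨

T-not⁻ : ∀ {a} → T (not a) → ¬ T a
T-not⁻ {false} _ ()

T-not⁺ : ∀ {a} → ¬ T a → T (not a)
T-not⁺ {true}  ¬a = ¬a _
T-not⁺ {false} _  = _

data AtMostOne : Bool → Bool → Bool → Set where
  only₁ : AtMostOne true false false
  only₂ : AtMostOne false true false
  only₃ : AtMostOne false false true
  none  : AtMostOne false false false

atMostOne : ∀ {a b c} → (T a → ¬ T b) → (T a → ¬ T c) → (T b → ¬ T c) → AtMostOne a b c
atMostOne {true}  {true}  {_}     ab _  _  = ⊥-elim (ab _ _)
atMostOne {true}  {false} {true}  _  ac _  = ⊥-elim (ac _ _)
atMostOne {true}  {false} {false} _  _  _  = only₁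
atMostOne {false} {true}  {true}  _  _  bc = ⊥-elim (bc _ _)
atMostOne {false} {true}  {false} _  _  _  = only₂
atMostOne {false} {false} {true}  _  _  _  = only₃
atMostOne {false} {false} {false} _  _  _  = none

exactlyTwo⇒¬all : ∀ a b c → T ((b ∧ c ∧ not a) ∨ (c ∧ a ∧ not b) ∨ (a ∧ b ∧ not c)) → ¬ T (a ∧ b ∧ c)
exactlyTwo⇒¬all true  true  true  ()
exactlyTwo⇒¬all true  true  false _ ()
exactlyTwo⇒¬all true  false _     _ ()
exactlyTwo⇒¬all false _     _     _ ()

-- i₁, i₂, i₃ are the indicators of I⁻, II, III at a cell; a, b those of A, B.
P-pointwise : ∀ {i₁ i₂ i₃} a b → AtMostOne i₁ i₂ i₃ → (T a → T (i₁ ∨ i₃)) → (T b → T (i₂ ∨ i₃))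
  → (a ∨ (i₃ ∧ b ∧ not a) ≡ (a ∨ b) ∧ (i₁ ∨ i₃))
  × (b ∧ not (i₃ ∧ b ∧ not a) ≡ ((a ∨ b) ∧ i₂) ∨ (a ∧ b))
P-pointwise false false only₁ _  _  = refl , refl
P-pointwise true  false only₁ _  _  = refl , refl
P-pointwise _     true  only₁ _  b⊆ = ⊥-elim (b⊆ _)
P-pointwise false false only₂ _  _  = refl , refl
P-pointwise false true  only₂ _  _  = refl , refl
P-pointwise true  _     only₂ a⊆ _  = ⊥-elim (a⊆ _)
P-pointwise false false only₃ _  _  = refl , refl
P-pointwise false true  only₃ _  _  = refl , refl
P-pointwise true  false only₃ _  _  = refl , refl
P-pointwise true  true  only₃ _  _  = refl , refl
P-pointwise false false none  _  _  = refl , refl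
P-pointwise false true  none  _  b⊆ = ⊥-elim (b⊆ _)
P-pointwise true  _     none  a⊆ _  = ⊥-elim (a⊆ _)

Finite-∪ : ∀ {X Y} → Finite X → Finite Y → Finite (λ w → X w ∨ Y w)
Finite-∪ {X} (l , X⊆l) (m , Y⊆m) = l ++ m , λ w → [ ∈-++⁺ˡ ∘ X⊆l w , ∈-++⁺ʳ l ∘ Y⊆m w ] ∘ T-∨⁻ {X w}

Finite-⊆ : ∀ {X Y} → (∀ w → T (Y w) → T (X w)) → Finite X → Finite Y
Finite-⊆ Y⊆X (l , X⊆l) = l , λ w → X⊆l w ∘ Y⊆X w

part-antitone : (μ : Partition) (t : ℕ) → part μ (suc t) ≤ part μ t
part-antitone record { parts = [] }     _ = z≤n
part-antitone record { parts = _ ∷ [] } _ = z≤n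
part-antitone record { parts = _ ∷ _ ∷ _ ; nonincreasing = q≤p ∷ _ } zero = q≤p
part-antitone
  record { parts = _ ∷ q ∷ qs ; nonincreasing = _ ∷ lk ; positive = _ ∷ pos } (suc t) =
  part-antitone record { parts = q ∷ qs ; nonincreasing = lk ; positive = pos } t

inPart-predᵘ : (μ : Partition) (u v : ℕ) → T (inPart μ (+ suc u) (+ v)) → T (inPart μ (+ u) (+ v))
inPart-predᵘ μ u v h = <⇒<ᵇ (<⇒≤ (<ᵇ⇒< (suc u) (part μ v) h))

inPart-predᵛ : (μ : Partition) (u v : ℕ) → T (inPart μ (+ u) (+ suc v)) → T (inPart μ (+ u) (+ v))
inPart-predᵛ μ u v h = <⇒<ᵇ (<-≤-trans (<ᵇ⇒< u (part μ (suc v)) h) (part-antitone μ v))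

inPart⇒nonneg : (μ : Partition) (u v : ℤ) → T (inPart μ u v) → T (isNonneg u) × T (isNonneg v)
inPart⇒nonneg μ (+ _) (+ _)     _ = _ , _
inPart⇒nonneg μ (+ _) -[1+ _ ] ()
inPart⇒nonneg μ -[1+ _ ] _     ()

isNonneg-pred⁻ : ∀ x → T (isNonneg (x - 1ℤ)) → T (isNonneg x)
isNonneg-pred⁻ (+ _) _ = _

nonneg⁻ : ∀ x y z → T (nonneg (x , y , z)) → T (isNonneg x) × T (isNonneg y) × T (isNonneg z)
nonneg⁻ (+ _) (+ _) (+ _) _ = _ , _ , _

nonneg⁺ : ∀ x y z → T (isNonneg x) → T (isNonneg y) → T (isNonneg z) → T (nonneg (x , y , z))
nonneg⁺ (+ _) (+ _) (+ _) _ _ _ = _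

shift-nonneg⁻ : ∀ i w → T (nonneg (shift i w)) → T (nonneg w)
shift-nonneg⁻ zero (x , y , z) h =
  let (x' , y' , z') = nonneg⁻ (x - 1ℤ) y z h in nonneg⁺ x y z (isNonneg-pred⁻ x x') y' z'
shift-nonneg⁻ (suc zero) (x , y , z) h =
  let (x' , y' , z') = nonneg⁻ x (y - 1ℤ) z h in nonneg⁺ x y z x' (isNonneg-pred⁻ y y') z'
shift-nonneg⁻ (suc (suc zero)) (x , y , z) h =
  let (x' , y' , z') = nonneg⁻ x y (z - 1ℤ) h in nonneg⁺ x y z x' y' (isNonneg-pred⁻ z z')

module _ (μ₁ μ₂ μ₃ : Partition) where
  open Regions μ₁ μ₂ μ₃

  Cyl₀₁⇒nonneg : ∀ w → T (Cyl zero w) → T (Cyl (suc zero) w) → T (nonneg w)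
  Cyl₀₁⇒nonneg (x , y , z) c₀ c₁ =
    let (y' , z') = inPart⇒nonneg μ₁ y z c₀ ; (_ , x') = inPart⇒nonneg μ₂ z x c₁
    in nonneg⁺ x y z x' y' z'

  Cyl₁₂⇒nonneg : ∀ w → T (Cyl (suc zero) w) → T (Cyl (suc (suc zero)) w) → T (nonneg w)
  Cyl₁₂⇒nonneg (x , y , z) c₁ c₂ =
    let (z' , x') = inPart⇒nonneg μ₂ z x c₁ ; (_ , y') = inPart⇒nonneg μ₃ x y c₂
    in nonneg⁺ x y z x' y' z'

  Cyl₂₀⇒nonneg : ∀ w → T (Cyl (suc (suc zero)) w) → T (Cyl zero w) → T (nonneg w)
  Cyl₂₀⇒nonneg (x , y , z) c₂ c₀ =
    let (x' , y') = inPart⇒nonneg μ₃ x y c₂ ; (_ , z') = inPart⇒nonneg μ₁ y z c₀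
    in nonneg⁺ x y z x' y' z'

  III⇒nonneg : ∀ w → T (III w) → T (nonneg w)
  III⇒nonneg w h = let (c₀ , c₁ , _) = T-∧³⁻ {Cyl zero w} h in Cyl₀₁⇒nonneg w c₀ c₁

  II⇒nonneg : ∀ w → T (II w) → T (nonneg w)
  II⇒nonneg w h with T-∨⁻ h
  ... | inj₁ h₀ = let (c₁ , c₂ , _) = T-∧³⁻ {Cyl (suc zero) w} h₀ in Cyl₁₂⇒nonneg w c₁ c₂
  ... | inj₂ h₁₂ with T-∨⁻ h₁₂
  ...   | inj₁ h₁ = let (c₂ , c₀ , _) = T-∧³⁻ {Cyl (suc (suc zero)) w} h₁ in Cyl₂₀⇒nonneg w c₂ c₀
  ...   | inj₂ h₂ = let (c₀ , c₁ , _) = T-∧³⁻ {Cyl zero w} h₂ in Cyl₀₁⇒nonneg w c₀ c₁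

  I⁻⇒¬nonneg : ∀ w → T (I⁻ w) → ¬ T (nonneg w)
  I⁻⇒¬nonneg w h with T-∨⁻ h
  ... | inj₁ h₀ = T-not⁻ (proj₂ (T-∧⁻ {Cyl zero w} h₀))
  ... | inj₂ h₁₂ with T-∨⁻ h₁₂
  ...   | inj₁ h₁ = T-not⁻ (proj₂ (T-∧⁻ {Cyl (suc zero) w} h₁))
  ...   | inj₂ h₂ = T-not⁻ (proj₂ (T-∧⁻ {Cyl (suc (suc zero)) w} h₂))

  regions-disjoint : ∀ w → AtMostOne (I⁻ w) (II w) (III w)
  regions-disjoint w = atMostOne
    (λ i₁ → I⁻⇒¬nonneg w i₁ ∘ II⇒nonneg w)
    (λ i₁ → I⁻⇒¬nonneg w i₁ ∘ III⇒nonneg w)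
    (exactlyTwo⇒¬all (Cyl zero w) (Cyl (suc zero) w) (Cyl (suc (suc zero)) w))

  III-pred : ∀ i w → T (III w) → T (nonneg (shift i w)) → T (III (shift i w))
  III-pred i w h = pred i w (III⇒nonneg w h) h
    where
    pred : ∀ i w → T (nonneg w) → T (III w) → T (nonneg (shift i w)) → T (III (shift i w))
    pred zero (+ suc x , + y , + z) _ h _ =
      let (c₀ , c₁ , c₂) = T-∧³⁻ {inPart μ₁ (+ y) (+ z)} h
      in T-∧³⁺ {inPart μ₁ (+ y) (+ z)} (c₀ , inPart-predᵛ μ₂ z x c₁ , inPart-predᵘ μ₃ x y c₂)
    pred (suc zero) (+ x , + suc y , + z) _ h _ =
      let (c₀ , c₁ , c₂) = T-∧³⁻ {inPart μ₁ (+ suc y) (+ z)} h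
      in T-∧³⁺ (inPart-predᵘ μ₁ y z c₀ , c₁ , inPart-predᵛ μ₃ x y c₂)
    pred (suc (suc zero)) (+ x , + y , + suc z) _ h _ =
      let (c₀ , c₁ , c₂) = T-∧³⁻ {inPart μ₁ (+ y) (+ suc z)} h
      in T-∧³⁺ (inPart-predᵛ μ₁ y z c₀ , inPart-predᵘ μ₂ z x c₁ , c₂)
    pred zero             (+ zero , + _ , + _) _ _ ()
    pred (suc zero)       (+ _ , + zero , + _) _ _ ()
    pred (suc (suc zero)) (+ _ , + _ , + zero) _ _ ()

  P-isAB : ∀ A B → IsAB A B → IsAB (P₁ A B) (P₂ A B)
  P-isAB A B ab = record
    { finiteA = Finite-⊆ P₁⊆A∪B (Finite-∪ finiteA finiteB)
    ; finiteB = Finite-⊆ (λ w → proj₁ ∘ T-∧⁻ {B w}) finiteB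
    ; A⊆      = P₁⊆I⁻∪III
    ; B⊆      = λ w → B⊆ w ∘ proj₁ ∘ T-∧⁻ {B w}
    ; closedA = P₁-closed
    ; closedB = P₂-closed
    }
    where
    open IsAB ab

    moved⇒III : ∀ w → T (moved A B w) → T (III w)
    moved⇒III w = proj₁ ∘ T-∧⁻ {III w}

    moved⇒B : ∀ w → T (moved A B w) → T (B w)
    moved⇒B w = proj₁ ∘ T-∧⁻ {B w} ∘ proj₂ ∘ T-∧⁻ {III w}

    P₁⊆A∪B : ∀ w → T (P₁ A B w) → T (A w ∨ B w)
    P₁⊆A∪B w = [ T-∨⁺ˡ , T-∨⁺ʳ ∘ moved⇒B w ] ∘ T-∨⁻ {A w}

    P₁⊆I⁻∪III : ∀ w → T (P₁ A B w) → T (I⁻ w ∨ III w)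
    P₁⊆I⁻∪III w = [ A⊆ w , T-∨⁺ʳ ∘ moved⇒III w ] ∘ T-∨⁻ {A w}

    moved-below : ∀ w n → T (I⁻ w ∨ III w) → BN w n → T (moved A B n) → T (P₁ A B w)
    moved-below w _ w∈ (i , refl) m with T-∨⁻ w∈
    ... | inj₁ w∈I⁻ = ⊥-elim (I⁻⇒¬nonneg w w∈I⁻ w≥0)
      where
      w≥0 : T (nonneg w)
      w≥0 = shift-nonneg⁻ i w (III⇒nonneg (shift i w) (moved⇒III (shift i w) m))
    ... | inj₂ w∈III with T? (A w)
    ...   | yes Aw  = T-∨⁺ˡ Aw
    ...   | no  ¬Aw = T-∨⁺ʳ (T-∧³⁺ (w∈III , Bw , T-not⁺ ¬Aw))
      where
      Bw : T (B w)
      Bw = closedB w (shift i w) (T-∨⁺ʳ w∈III) (i , refl) (moved⇒B (shift i w) m)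

    P₁-closed : ∀ w n → T (I⁻ w ∨ III w) → BN w n → T (P₁ A B n) → T (P₁ A B w)
    P₁-closed w n w∈ n∈BN = [ T-∨⁺ˡ ∘ closedA w n w∈ n∈BN , moved-below w n w∈ n∈BN ] ∘ T-∨⁻ {A n}

    unmoved-below : ∀ w n → BN w n → T (B n) → ¬ T (moved A B n) → ¬ T (moved A B w)
    unmoved-below w _ (i , refl) Bn n∉ m with T-∧³⁻ {III w} m | T? (A (shift i w))
    ... | w∈III , _ , ¬Aw | yes An = T-not⁻ ¬Aw (closedA w (shift i w) (T-∨⁺ʳ w∈III) (i , refl) An)
    ... | w∈III , _ , _   | no ¬An = n∉ (T-∧³⁺ (III-pred i w w∈III n≥0 , Bn , T-not⁺ ¬An))
      where
      n≥0 : T (nonneg (shift i w))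
      n≥0 = [ II⇒nonneg (shift i w) , III⇒nonneg (shift i w) ]
              (T-∨⁻ {II (shift i w)} (B⊆ (shift i w) Bn))

    P₂-closed : ∀ w n → T (II w ∨ III w) → BN w n → T (P₂ A B n) → T (P₂ A B w)
    P₂-closed w n w∈ n∈BN hn =
      let (Bn , n∉) = T-∧⁻ {B n} hn
      in T-∧⁺ (closedB w n w∈ n∈BN Bn , T-not⁺ (unmoved-below w n n∈BN Bn (T-not⁻ n∉)))

  IsAB⇒P-pointwise : ∀ A B → IsAB A B → ∀ w
    → (P₁ A B w ≡ (A w ∨ B w) ∧ (I⁻ w ∨ III w))
    × (P₂ A B w ≡ ((A w ∨ B w) ∧ II w) ∨ (A w ∧ B w))
  IsAB⇒P-pointwise A B ab w = P-pointwise (A w) (B w) (regions-disjoint w) (A⊆ w) (B⊆ w)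
    where open IsAB ab

  module _ (L : Set) (e : Fin 3 → L) where
    open Labels L e

    P-on≡ABbase : (π : LBC) (A B : Subset) → IsAB A B → On π A B
      → (∀ w → P₁ A B w ≡ ABbase₁ π w) × (∀ w → P₂ A B w ≡ ABbase₂ π w)
    P-on≡ABbase π A B ab on =
      (λ w → trans (proj₁ (IsAB⇒P-pointwise A B ab w)) (cong (_∧ (I⁻ w ∨ III w)) (proj₁ (on w)))) ,
      (λ w → trans (proj₂ (IsAB⇒P-pointwise A B ab w))
                   (cong₂ (λ box unl → (box ∧ II w) ∨ unl) (proj₁ (on w)) (proj₂ (on w))))

lemma4p26 : (μ₁ μ₂ μ₃ : Partition) (L : Set) (e : Fin 3 → L)
    → (∀ i j → e i ≡ e j → i ≡ j)
    → let open Regions μ₁ μ₂ μ₃ in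
      let open Labels L e in
      ((A B : Subset) → IsAB A B → IsAB (P₁ A B) (P₂ A B))
      × ((π : LBC) (A B : Subset) → IsAB A B → On π A B
         → (∀ w → P₁ A B w ≡ ABbase₁ π w) × (∀ w → P₂ A B w ≡ ABbase₂ π w))
lemma4p26 μ₁ μ₂ μ₃ L e _ = P-isAB μ₁ μ₂ μ₃ , P-on≡ABbase μ₁ μ₂ μ₃ L e
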